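{- Let $R$ be a finite unital ring with $\mathrm{Rad}(R)=0$ (semisimple), and $U$ a subgroup of $R^\times$ with $-1\in U$. Then no two-sided ideal $I$ of $R$ with $I\neq0$ and $I\neq R$ is a homogeneous set in $\Gamma(R,U)$. In particular, if $\Gamma(R,U)$ is connected and anti-connected, then $\Gamma(R,U)$ is prime.
   Context: $\mathrm{Rad}(R)$ is the Jacobson radical. The Cayley graph $\Gamma(R,U)$ has vertex set $R$, with $a,b$ adjacent iff $a-b\in U$. Anti-connected means the complement graph is connected. A vertex subset $X$ is homogeneous if every vertex outside $X$ is adjacent to all or none of $X$; non-trivial if $2\le|X|<|V|$; a graph is prime if it has no non-trivial homogeneous set. -}

module Defs where

open import Level using (Level; _⊔_) renaming (suc to lsuc)
open import Algebra.Bundles using (Ring)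
open import Data.Nat using (ℕ)
open import Data.Fin using (Fin)
open import Data.Product using (Σ; ∃; ∃-syntax; _×_; _,_)
open import Data.Sum using (_⊎_)
open import Relation.Nullary using (¬_)
open import Relation.Binary.PropositionalEquality as ≡ using (_≡_)
open import Relation.Binary.Construct.Closure.ReflexiveTransitive using (Star)
open import Function.Bundles using (Inverse)

module _ {c ℓ : Level} (R : Ring c ℓ) where
  open Ring R

  Subset : (p : Level) → Set (c ⊔ ℓ ⊔ lsuc p)
  Subset p = Σ (Carrier → Set p) λ S → ∀ {x y} → x ≈ y → S x → S y

  IsFinite : Set (c ⊔ ℓ)
  IsFinite = ∃[ n ] Inverse setoid (≡.setoid (Fin n))

  IsUnit : Carrier → Set (c ⊔ ℓ)
  IsUnit u = ∃[ v ] ((u * v ≈ 1#) × (v * u ≈ 1#))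

  IsLeftIdeal : ∀ {p} → (Carrier → Set p) → Set (c ⊔ p)
  IsLeftIdeal M = M 0# × (∀ {x y} → M x → M y → M (x + y))
                × (∀ {x} → M x → M (- x)) × (∀ r {x} → M x → M (r * x))

  IsMaximalLeftIdeal : ∀ {p} → Subset p → Set (c ⊔ ℓ ⊔ lsuc p)
  IsMaximalLeftIdeal {p} (M , _) =
    IsLeftIdeal M × ¬ (∀ x → M x) ×
    (∀ (J : Subset p) → let (J' , _) = J in IsLeftIdeal J' →
       (∀ x → M x → J' x) → (∀ x → J' x → M x) ⊎ (∀ x → J' x))

  InRad : (p : Level) → Carrier → Set (c ⊔ ℓ ⊔ lsuc p)
  InRad p x = ∀ (M : Subset p) → IsMaximalLeftIdeal M → let (M' , _) = M in M' x

  RadZero : (p : Level) → Set (c ⊔ ℓ ⊔ lsuc p)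
  RadZero p = ∀ x → InRad p x → x ≈ 0#

  IsTwoSidedIdeal : ∀ {p} → Subset p → Set (c ⊔ p)
  IsTwoSidedIdeal (I , _) = IsLeftIdeal I × (∀ r {x} → I x → I (x * r))

  IsUnitSubgroup : ∀ {p} → Subset p → Set (c ⊔ ℓ ⊔ p)
  IsUnitSubgroup (U , _) =
    (∀ {u} → U u → IsUnit u) × U 1# × (∀ {u v} → U u → U v → U (u * v))
    × (∀ {u v} → U u → u * v ≈ 1# → v * u ≈ 1# → U v)

  module _ {p} (U : Subset p) where
    Adj : Carrier → Carrier → Set p
    Adj a b = let (U' , _) = U in U' (a + (- b))

    CoAdj : Carrier → Carrier → Set (ℓ ⊔ p)
    CoAdj a b = ¬ (a ≈ b) × ¬ Adj a b

    Connected : Set (c ⊔ p)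
    Connected = ∀ a b → Star Adj a b

    AntiConnected : Set (c ⊔ ℓ ⊔ p)
    AntiConnected = ∀ a b → Star CoAdj a b

    Homogeneous : ∀ {q} → Subset q → Set (c ⊔ p ⊔ q)
    Homogeneous (X , _) = ∀ v → ¬ X v →
      (∀ x → X x → Adj v x) ⊎ (∀ x → X x → ¬ Adj v x)

    NonTrivial : ∀ {q} → Subset q → Set (c ⊔ ℓ ⊔ q)
    NonTrivial (X , _) = (∃[ x ] ∃[ y ] (X x × X y × ¬ (x ≈ y))) × (∃[ v ] ¬ X v)

    Prime : (q : Level) → Set (c ⊔ ℓ ⊔ p ⊔ lsuc q)
    Prime q = ∀ (X : Subset q) → NonTrivial X → ¬ Homogeneous X

-- If a proper left ideal L is homogeneous in Γ(R,U), then 1 ∉ L, being adjacent to 0 ∈ L, is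
-- adjacent to all of L, so 1 + r x ∈ U for every r and every x ∈ L. Such an x lies in every
-- maximal left ideal M, for otherwise M + R x = R would put a unit 1 + r x into M; so x ∈ Rad(R).
--
-- When Γ(R,U) and its complement are connected, two proper homogeneous sets through 0 cannot
-- cover R: a path and an anti-path from inside to outside the first would cross the cut by an
-- edge and a non-edge, yet adjacency across that cut is uniform. So such sets are closed under
-- union and, R being finite, their union is the largest of them. It is stable under translation
-- by its own elements and under multiplication by U, and every r ∈ R is a sum of elements of U
-- along a path to 0, so it is a proper homogeneous left ideal. A nontrivial homogeneous X,
-- translated by x₀ ∈ X, puts y₀ - x₀ ≠ 0 into it.

module Submission where

open import Defs
open import Level using (Level; _⊔_)
open import Algebra.Bundles using (Ring)
open import Data.Nat using (zero; suc)
open import Data.Fin using (Fin; zero; suc)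
open import Data.Fin.Properties using (sequence)
open import Data.Product using (Σ-syntax; ∃; ∃-syntax; _×_; _,_; proj₁; proj₂)
open import Data.Sum using (inj₁; inj₂; [_,_]′)
open import Data.Empty using (⊥-elim)
open import Effect.Monad using (module RawMonad)
open import Function using (_∘_)
open import Function.Bundles using (Inverse)
open import Relation.Binary.Bundles using (Setoid)
open import Relation.Binary.Core using (Rel)
open import Relation.Binary.Definitions using (Symmetric; _Respects_)
open import Relation.Binary.PropositionalEquality as ≡ using ()
open import Relation.Binary.Construct.Closure.ReflexiveTransitive using (Star; ε; _◅_)
open import Relation.Nullary using (¬_; Dec; yes; no)
open import Relation.Nullary.Decidable using (decidable-stable; map′; ¬¬-excluded-middle)
open import Relation.Nullary.Negation using (¬¬-Monad; ¬¬-map)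
open import Relation.Unary using (Pred; Decidable; _∪_; _⊢_)
open import Relation.Unary.Properties using (_∪?_)

module _ {a q} {A : Set a} {P : Pred A q} where

  ¬∀⇒¬¬∃¬ : Decidable P → ¬ (∀ x → P x) → ¬ ¬ ∃ λ x → ¬ P x
  ¬∀⇒¬¬∃¬ P? ¬∀P ¬∃¬P = ¬∀P λ x → decidable-stable (P? x) λ ¬Px → ¬∃¬P (x , ¬Px)

  crossing-edge : ∀ {e} {_~_ : Rel A e} → Decidable P → ∀ {s t} → Star _~_ s t → P s → ¬ P t →
                  ∃[ x ] ∃[ y ] (P x × ¬ P y × x ~ y)
  crossing-edge P? ε Ps ¬Pt = ⊥-elim (¬Pt Ps)
  crossing-edge P? (_◅_ {j = y} s~y y~*t) Ps ¬Pt with P? y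
  ... | yes Py = crossing-edge P? y~*t Py ¬Pt
  ... | no ¬Py = _ , y , Ps , ¬Py , s~y

finite⇒¬¬decidable : ∀ {c ℓ q n} (S : Setoid c ℓ) → Inverse S (≡.setoid (Fin n)) →
                     let open Setoid S in
                     {P : Pred Carrier q} → P Respects _≈_ → ¬ ¬ Decidable P
finite⇒¬¬decidable S enum {P} P-resp =
  ¬¬-map (λ P∘from? y → map′ (P-resp (strictlyInverseʳ y)) (P-resp (sym (strictlyInverseʳ y)))
                              (P∘from? (to y)))
         (sequence rawApplicative {P = λ i → Dec (P (from i))} λ i → ¬¬-excluded-middle)
  where
  open Setoid S using (sym)
  open Inverse enum using (to; from; strictlyInverseʳ)
  open RawMonad ¬¬-Monad using (rawApplicative)

module Graph {v e} {V : Set v} (_~_ : Rel V e) (~-sym : Symmetric _~_) where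

  WeaklyHomogeneous : ∀ {q} → Pred V q → Set (v ⊔ e ⊔ q)
  WeaklyHomogeneous S = ∀ {w x y} → ¬ S w → S x → S y → w ~ x → w ~ y

  module _ {q r} {S : Pred V q} {T : Pred V r}
           (S-hom : WeaklyHomogeneous S) (T-hom : WeaklyHomogeneous T) where

    ∪-weaklyHomogeneous : ∀ {z} → S z → T z → WeaklyHomogeneous (S ∪ T)
    ∪-weaklyHomogeneous {z} Sz Tz {w} {x} {y} w∉S∪T x∈S∪T y∈S∪T w~x =
      z→y y∈S∪T (x→z x∈S∪T w~x)
      where
      x→z : (S ∪ T) x → w ~ x → w ~ z
      x→z (inj₁ Sx) = S-hom (w∉S∪T ∘ inj₁) Sx Sz
      x→z (inj₂ Tx) = T-hom (w∉S∪T ∘ inj₂) Tx Tz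
      z→y : (S ∪ T) y → w ~ z → w ~ y
      z→y (inj₁ Sy) = S-hom (w∉S∪T ∘ inj₁) Sz Sy
      z→y (inj₂ Ty) = T-hom (w∉S∪T ∘ inj₂) Tz Ty

    -- The complement of S lies in T, so a cut edge can be rerouted through a ∈ S ∖ T.
    cover⇒cut-uniform : (∀ x → (S ∪ T) x) → ∀ {a} → ¬ T a →
                        ∀ {x y x′ y′} → S x → ¬ S y → S x′ → ¬ S y′ → x ~ y → x′ ~ y′
    cover⇒cut-uniform cover {a} ¬Ta {x} {y} {x′} {y′} Sx ¬Sy Sx′ ¬Sy′ x~y =
      ~-sym (S-hom ¬Sy′ Sa Sx′ (~-sym a~y′))
      where
      T-outside-S : ∀ {z} → ¬ S z → T z
      T-outside-S {z} ¬Sz = [ (λ Sz → ⊥-elim (¬Sz Sz)) , (λ Tz → Tz) ]′ (cover z)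
      Sa : S a
      Sa = [ (λ Sa → Sa) , (λ Ta → ⊥-elim (¬Ta Ta)) ]′ (cover a)
      a~y′ : a ~ y′
      a~y′ = T-hom ¬Ta (T-outside-S ¬Sy) (T-outside-S ¬Sy′) (~-sym (S-hom ¬Sy Sx Sa (~-sym x~y)))

  module _ {e′} {_≁_ : Rel V e′} (≁⇒¬~ : ∀ {x y} → x ≁ y → ¬ x ~ y)
           (connected : ∀ x y → Star _~_ x y) (anticonnected : ∀ x y → Star _≁_ x y) where

    ¬proper-cover : ∀ {q r} {S : Pred V q} {T : Pred V r} →
                    Decidable S → Decidable T → WeaklyHomogeneous S → WeaklyHomogeneous T →
                    ¬ (∀ x → S x) → ¬ (∀ x → T x) → ∀ {s} → S s → ¬ (∀ x → (S ∪ T) x)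
    ¬proper-cover S? T? S-hom T-hom S-proper T-proper {s} Ss cover =
      ¬∀⇒¬¬∃¬ S? S-proper λ (b , ¬Sb) → ¬∀⇒¬¬∃¬ T? T-proper λ (a , ¬Ta) →
        let (x , y , Sx , ¬Sy , x~y) = crossing-edge S? (connected s b) Ss ¬Sb
            (x′ , y′ , Sx′ , ¬Sy′ , x′≁y′) = crossing-edge S? (anticonnected s b) Ss ¬Sb
        in ≁⇒¬~ x′≁y′ (cover⇒cut-uniform S-hom T-hom cover ¬Ta Sx ¬Sy Sx′ ¬Sy′ x~y)

module Radical {c ℓ} (R : Ring c ℓ) where
  open Ring R
  open import Algebra.Properties.Ring R
  open import Relation.Binary.Reasoning.Setoid setoid

  leftIdeal-unit⇒full : ∀ {q} {M : Pred Carrier q} → M Respects _≈_ → IsLeftIdeal R M →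
                        ∀ {u} → IsUnit R u → M u → ∀ z → M z
  leftIdeal-unit⇒full M-resp (_ , _ , _ , M-*) (v , _ , vu≈1) Mu z =
    M-resp (*-identityʳ z) (M-* z (M-resp vu≈1 (M-* v Mu)))

  st≈1⇒s[ty]≈y : ∀ {s t} → s * t ≈ 1# → ∀ y → s * (t * y) ≈ y
  st≈1⇒s[ty]≈y {s} {t} st≈1 y = trans (sym (*-assoc s t y)) (trans (*-congʳ st≈1) (*-identityˡ y))

  y+0x≈y : ∀ y x → y + 0# * x ≈ y
  y+0x≈y y x = trans (+-congˡ (zeroˡ x)) (+-identityʳ y)

  x+[-1]x≈0 : ∀ x → x + - 1# * x ≈ 0#
  x+[-1]x≈0 x = trans (+-congˡ (-1*x≈-x x)) (-‿inverseʳ x)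

  [y+rx]+[z+sx]≈[y+z]+[r+s]x : ∀ y r z s x → (y + r * x) + (z + s * x) ≈ (y + z) + (r + s) * x
  [y+rx]+[z+sx]≈[y+z]+[r+s]x y r z s x = begin
    (y + r * x) + (z + s * x) ≈⟨ +-assoc y (r * x) (z + s * x) ⟩
    y + (r * x + (z + s * x)) ≈⟨ +-congˡ (+-comm (r * x) (z + s * x)) ⟩
    y + ((z + s * x) + r * x) ≈⟨ +-congˡ (+-assoc z (s * x) (r * x)) ⟩
    y + (z + (s * x + r * x)) ≈⟨ +-assoc y z (s * x + r * x) ⟨
    (y + z) + (s * x + r * x) ≈⟨ +-congˡ (+-comm (s * x) (r * x)) ⟩
    (y + z) + (r * x + s * x) ≈⟨ +-congˡ (distribʳ x r s) ⟨
    (y + z) + (r + s) * x     ∎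

  -[y+rx]≈-y+[-r]x : ∀ y r x → - (y + r * x) ≈ - y + - r * x
  -[y+rx]≈-y+[-r]x y r x = begin
    - (y + r * x)     ≈⟨ -‿+-comm y (r * x) ⟨
    - y + - (r * x)   ≈⟨ +-congˡ (-‿distribˡ-* r x) ⟩
    - y + - r * x     ∎

  s[y+rx]≈sy+[sr]x : ∀ s y r x → s * (y + r * x) ≈ s * y + (s * r) * x
  s[y+rx]≈sy+[sr]x s y r x = trans (distribˡ s y (r * x)) (+-congˡ (sym (*-assoc s r x)))

  unit-shifts⇒inRad : ∀ {q x} → IsFinite R → (∀ r → IsUnit R (1# + r * x)) → InRad R q x
  unit-shifts⇒inRad {q} {x} (n , enum) 1+rx-unit (M , M-resp)
                    (M-ideal@(M-0 , M-+ , M-neg , M-*) , M-proper , M-maximal) =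
    [ (λ J⊆M → J⊆M x x∈J) , (λ J-full → ⊥-elim (M-proper (1∈J⇒M-full (J-full 1#)))) ]′
      (M-maximal J J-ideal (λ y My → J-intro 0# (M-resp (sym (y+0x≈y y x)) My)))
    where
    open Inverse enum using (to; from; strictlyInverseʳ)
    -- M + R x; ranging the coefficient over Fin n rather than Carrier keeps J at level q.
    J′ : Pred Carrier q
    J′ y = Σ[ j ∈ Fin n ] M (y + from j * x)

    J : Subset R q
    J = J′ , λ y≈z (j , Mj) → j , M-resp (+-congʳ y≈z) Mj

    J-intro : ∀ {y} r → M (y + r * x) → J′ y
    J-intro r My+rx = to r , M-resp (+-congˡ (*-congʳ (sym (strictlyInverseʳ r)))) My+rx

    J-ideal : IsLeftIdeal R J′
    J-ideal = J-intro 0# (M-resp (sym (y+0x≈y 0# x)) M-0)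
            , (λ { {y} {z} (j , My) (k , Mz) → J-intro (from j + from k)
                     (M-resp ([y+rx]+[z+sx]≈[y+z]+[r+s]x y (from j) z (from k) x) (M-+ My Mz)) })
            , (λ { {y} (j , My) → J-intro (- from j)
                     (M-resp (-[y+rx]≈-y+[-r]x y (from j) x) (M-neg My)) })
            , (λ { s {y} (j , My) → J-intro (s * from j)
                     (M-resp (s[y+rx]≈sy+[sr]x s y (from j) x) (M-* s My)) })

    x∈J : J′ x
    x∈J = J-intro (- 1#) (M-resp (sym (x+[-1]x≈0 x)) M-0)

    1∈J⇒M-full : J′ 1# → ∀ z → M z
    1∈J⇒M-full (j , M1+rx) = leftIdeal-unit⇒full M-resp M-ideal (1+rx-unit (from j)) M1+rx

module Cayley {c ℓ p} (R : Ring c ℓ) (U : Subset R p) (U-subgroup : IsUnitSubgroup R U)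
              (-1∈U : proj₁ U (Ring.-_ R (Ring.1# R))) where
  open Ring R hiding (zero)
  open import Algebra.Properties.Ring R
  open import Relation.Binary.Reasoning.Setoid setoid
  open Radical R

  _∈U : Carrier → Set p
  _∈U = proj₁ U

  ∈U-resp : _∈U Respects _≈_
  ∈U-resp = proj₂ U

  ∈U⇒unit : ∀ {u} → u ∈U → IsUnit R u
  ∈U⇒unit = proj₁ U-subgroup

  1∈U : 1# ∈U
  1∈U = proj₁ (proj₂ U-subgroup)

  ∈U-* : ∀ {u v} → u ∈U → v ∈U → (u * v) ∈U
  ∈U-* = proj₁ (proj₂ (proj₂ U-subgroup))

  ∈U-inverse : ∀ {u v} → u ∈U → u * v ≈ 1# → v * u ≈ 1# → v ∈U
  ∈U-inverse = proj₂ (proj₂ (proj₂ U-subgroup))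

  _∼_ : Rel Carrier p
  _∼_ = Adj R U

  ∼-sym : Symmetric _∼_
  ∼-sym {a} {b} a∼b = ∈U-resp (trans (-1*x≈-x (a - b)) (⁻¹-anti-homo‿- a b)) (∈U-* -1∈U a∼b)

  1∼0 : 1# ∼ 0#
  1∼0 = ∈U-resp (sym (trans (+-congˡ -0#≈0#) (+-identityʳ 1#))) 1∈U

  open Graph _∼_ ∼-sym

  homogeneous⇒weaklyHomogeneous : ∀ {q} (X : Subset R q) → Homogeneous R U X →
                                  WeaklyHomogeneous (proj₁ X)
  homogeneous⇒weaklyHomogeneous X X-hom {w} ¬Xw Xx Xy w∼x =
    [ (λ w∼X → w∼X _ Xy) , (λ w≁X → ⊥-elim (w≁X _ Xx w∼x)) ]′ (X-hom w ¬Xw)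

  weaklyHomogeneous-leftIdeal⊆Rad : ∀ {q r} {L : Pred Carrier q} → IsFinite R → L Respects _≈_ →
                                    IsLeftIdeal R L → ¬ (∀ x → L x) → WeaklyHomogeneous L →
                                    ∀ {x} → L x → InRad R r x
  weaklyHomogeneous-leftIdeal⊆Rad {L = L} finite L-resp L-ideal@(L-0 , _ , L-neg , L-*) L-proper L-hom Lx =
    unit-shifts⇒inRad finite λ s →
      ∈U⇒unit (∈U-resp (+-congˡ (-‿involutive _)) (L-hom 1∉L L-0 (L-neg (L-* s Lx)) 1∼0))
    where
    1∉L : ¬ L 1#
    1∉L L1 = L-proper (leftIdeal-unit⇒full L-resp L-ideal (∈U⇒unit 1∈U) L1)

  module _ {q} {L : Pred Carrier q} (L-resp : L Respects _≈_) (L-0 : L 0#)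
           (L-+ : ∀ {x y} → L x → L y → L (x + y)) (L-U : ∀ {u x} → u ∈U → L x → L (u * x)) where

    path-to-0⇒*-closed : ∀ {r x} → Star _∼_ r 0# → L x → L (r * x)
    path-to-0⇒*-closed {x = x} ε Lx = L-resp (sym (zeroˡ x)) L-0
    path-to-0⇒*-closed {r} {x} (_◅_ {j = y} r∼y y∼*0) Lx =
      L-resp r*x≈ (L-+ (L-U r∼y Lx) (path-to-0⇒*-closed y∼*0 Lx))
      where
      r*x≈ : (r - y) * x + y * x ≈ r * x
      r*x≈ = trans (sym (distribʳ x (r - y) y)) (*-congʳ (//-rightDividesˡ y r))

  record IsAutomorphism (f : Carrier → Carrier) : Set (c ⊔ ℓ ⊔ p) where
    field
      cong       : ∀ {x y} → x ≈ y → f x ≈ f y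
      surjective : ∀ y → ∃[ x ] f x ≈ y
      preserves  : ∀ {x y} → x ∼ y → f x ∼ f y
      reflects   : ∀ {x y} → f x ∼ f y → x ∼ y

  +-isAutomorphism : ∀ a → IsAutomorphism (_+ a)
  +-isAutomorphism a = record
    { cong       = +-congʳ
    ; surjective = λ y → y - a , //-rightDividesˡ a y
    ; preserves  = ∈U-resp (sym ([x+a]-[y+a]≈x-y _ _))
    ; reflects   = ∈U-resp ([x+a]-[y+a]≈x-y _ _)
    }
    where
    [x+a]-[y+a]≈x-y : ∀ x y → (x + a) - (y + a) ≈ x - y
    [x+a]-[y+a]≈x-y x y = begin
      (x + a) - (y + a)     ≈⟨ +-congˡ (-‿+-comm y a) ⟨
      (x + a) + (- y - a)   ≈⟨ +-assoc x a (- y - a) ⟩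
      x + (a + (- y - a))   ≈⟨ +-congˡ (+-comm a (- y - a)) ⟩
      x + ((- y - a) + a)   ≈⟨ +-congˡ (//-rightDividesˡ a (- y)) ⟩
      x - y                 ∎

  *-isAutomorphism : ∀ {w} → w ∈U → IsAutomorphism (w *_)
  *-isAutomorphism {w} w∈U with ∈U⇒unit w∈U
  ... | u , wu≈1 , uw≈1 = record
    { cong       = *-congˡ
    ; surjective = λ y → u * y , st≈1⇒s[ty]≈y wu≈1 y
    ; preserves  = λ {x} {y} x∼y → ∈U-resp (x[y-z]≈xy-xz w x y) (∈U-* w∈U x∼y)
    ; reflects   = λ {x} {y} wx∼wy →
        ∈U-resp (trans (x[y-z]≈xy-xz u (w * x) (w * y))
                       (+-cong (st≈1⇒s[ty]≈y uw≈1 x) (-‿cong (st≈1⇒s[ty]≈y uw≈1 y))))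
                (∈U-* (∈U-inverse w∈U wu≈1 uw≈1) wx∼wy)
    }

  -- Homogeneous sets are also called modules of a graph.
  record IsProperModule {q} (S : Pred Carrier q) : Set (c ⊔ ℓ ⊔ p ⊔ q) where
    field
      decidable   : Decidable S
      respects    : S Respects _≈_
      homogeneous : WeaklyHomogeneous S
      proper      : ¬ (∀ x → S x)

  ⊢-isProperModule : ∀ {q f} {S : Pred Carrier q} →
                     IsAutomorphism f → IsProperModule S → IsProperModule (f ⊢ S)
  ⊢-isProperModule {f = f} {S} f-auto S-module = record
    { decidable   = decidable ∘ f
    ; respects    = respects ∘ cong
    ; homogeneous = λ ¬Sfw Sfx Sfy w∼x → reflects (homogeneous ¬Sfw Sfx Sfy (preserves w∼x))
    ; proper      = λ S∘f-full → proper λ y →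
                      let (x , fx≈y) = surjective y in respects fx≈y (S∘f-full x)
    }
    where
    open IsAutomorphism f-auto
    open IsProperModule S-module

  ∪-isProperModule : Connected R U → AntiConnected R U →
                     ∀ {q r} {S : Pred Carrier q} {T : Pred Carrier r} →
                     IsProperModule S → IsProperModule T → S 0# → T 0# → IsProperModule (S ∪ T)
  ∪-isProperModule connected anticonnected S-module T-module S0 T0 = record
    { decidable   = S.decidable ∪? T.decidable
    ; respects    = λ x≈y → [ inj₁ ∘ S.respects x≈y , inj₂ ∘ T.respects x≈y ]′
    ; homogeneous = ∪-weaklyHomogeneous S.homogeneous T.homogeneous S0 T0
    ; proper      = ¬proper-cover proj₂ connected anticonnected S.decidable T.decidable
                                  S.homogeneous T.homogeneous S.proper T.proper S0
    }
    where
    module S = IsProperModule S-module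
    module T = IsProperModule T-module

  module MaxModule (q : Level) (connected : Connected R U) (anticonnected : AntiConnected R U) where

    MaxModule₀ : Pred Carrier (c ⊔ ℓ ⊔ p ⊔ Level.suc q)
    MaxModule₀ y = Σ[ S ∈ Pred Carrier q ] (IsProperModule S × S 0# × S y)

    MaxModule₀-respects : MaxModule₀ Respects _≈_
    MaxModule₀-respects x≈y (S , S-module , S0 , Sx) =
      S , S-module , S0 , IsProperModule.respects S-module x≈y Sx

    merge : ∀ {x y} → MaxModule₀ x → MaxModule₀ y →
            Σ[ S ∈ Pred Carrier q ] (IsProperModule S × S 0# × S x × S y)
    merge (S , S-module , S0 , Sx) (T , T-module , T0 , Ty) =
      S ∪ T , ∪-isProperModule connected anticonnected S-module T-module S0 T0 ,
      inj₁ S0 , inj₁ Sx , inj₂ Ty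

    difference∈MaxModule₀ : ∀ {S : Pred Carrier q} → IsProperModule S →
                            ∀ {a b} → S a → S b → MaxModule₀ (b - a)
    difference∈MaxModule₀ {S} S-module {a} {b} Sa Sb =
      (_+ a) ⊢ S , ⊢-isProperModule (+-isAutomorphism a) S-module ,
      respects (sym (+-identityˡ a)) Sa , respects (sym (//-rightDividesˡ a b)) Sb
      where open IsProperModule S-module

    MaxModule₀-sub : ∀ {x y} → MaxModule₀ x → MaxModule₀ y → MaxModule₀ (x - y)
    MaxModule₀-sub Mx My =
      let (S , S-module , _ , Sx , Sy) = merge Mx My in difference∈MaxModule₀ S-module Sy Sx

    MaxModule₀-0 : ∀ {x} → MaxModule₀ x → MaxModule₀ 0#
    MaxModule₀-0 Mx = MaxModule₀-respects (-‿inverseʳ _) (MaxModule₀-sub Mx Mx)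

    MaxModule₀-add : ∀ {x y} → MaxModule₀ x → MaxModule₀ y → MaxModule₀ (x + y)
    MaxModule₀-add {x} {y} Mx My =
      MaxModule₀-respects (+-congˡ (trans (-‿cong (+-identityˡ (- y))) (-‿involutive y)))
                          (MaxModule₀-sub Mx (MaxModule₀-sub (MaxModule₀-0 My) My))

    MaxModule₀-scale : ∀ {u x} → u ∈U → MaxModule₀ x → MaxModule₀ (u * x)
    MaxModule₀-scale u∈U (S , S-module , S0 , Sx) with ∈U⇒unit u∈U
    ... | w , uw≈1 , wu≈1 =
      (w *_) ⊢ S , ⊢-isProperModule (*-isAutomorphism w∈U) S-module , respects (sym (zeroʳ w)) S0 ,
      respects (sym (st≈1⇒s[ty]≈y wu≈1 _)) Sx
      where
      open IsProperModule S-module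
      w∈U = ∈U-inverse u∈U uw≈1 wu≈1

    MaxModule₀-isLeftIdeal : ∀ {m} → MaxModule₀ m → IsLeftIdeal R MaxModule₀
    MaxModule₀-isLeftIdeal Mm =
      M0 , MaxModule₀-add , (λ Mx → MaxModule₀-respects (+-identityˡ _) (MaxModule₀-sub M0 Mx)) ,
      λ r → path-to-0⇒*-closed MaxModule₀-respects M0 MaxModule₀-add MaxModule₀-scale (connected r 0#)
      where M0 = MaxModule₀-0 Mm

    MaxModule₀-weaklyHomogeneous : WeaklyHomogeneous MaxModule₀
    MaxModule₀-weaklyHomogeneous ¬Mw Mx My =
      let (S , S-module , S0 , Sx , Sy) = merge Mx My
      in IsProperModule.homogeneous S-module (λ Sw → ¬Mw (S , S-module , S0 , Sw)) Sx Sy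

    ⋃-finite : ∀ {k} (g : Fin k → Carrier) → MaxModule₀ 0# → (∀ i → MaxModule₀ (g i)) →
               Σ[ S ∈ Pred Carrier q ] (IsProperModule S × S 0# × ∀ i → S (g i))
    ⋃-finite {zero} g (S , S-module , S0 , _) _ = S , S-module , S0 , λ ()
    ⋃-finite {suc k} g M0 Mg =
      let (S , S-module , S0 , Sg₀) = Mg zero
          (T , T-module , T0 , Tg) = ⋃-finite (g ∘ suc) M0 (Mg ∘ suc)
      in S ∪ T , ∪-isProperModule connected anticonnected S-module T-module S0 T0 , inj₁ S0 ,
         λ { zero → inj₁ Sg₀ ; (suc i) → inj₂ (Tg i) }

    MaxModule₀-proper : IsFinite R → ¬ (∀ x → MaxModule₀ x)
    MaxModule₀-proper (n , enum) full =
      let (S , S-module , _ , S∘from) = ⋃-finite from (full 0#) (full ∘ from)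
          open IsProperModule S-module
      in proper λ y → respects (strictlyInverseʳ y) (S∘from (to y))
      where open Inverse enum using (to; from; strictlyInverseʳ)

  leftIdeal-¬homogeneous : ∀ {q r} → IsFinite R → RadZero R r →
                           (I : Subset R q) → IsLeftIdeal R (proj₁ I) →
                           (∃[ x ] (proj₁ I x × ¬ x ≈ 0#)) → (∃[ y ] ¬ proj₁ I y) →
                           ¬ Homogeneous R U I
  leftIdeal-¬homogeneous finite rad (I , I-resp) I-ideal (x , Ix , x≉0) (y , ¬Iy) I-hom =
    x≉0 (rad x (weaklyHomogeneous-leftIdeal⊆Rad finite I-resp I-ideal (λ I-full → ¬Iy (I-full y))
                  (homogeneous⇒weaklyHomogeneous (I , I-resp) I-hom) Ix))

  connected-anticonnected⇒prime : ∀ {q r} → IsFinite R → RadZero R r →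
                                  Connected R U → AntiConnected R U → Prime R U q
  connected-anticonnected⇒prime {q} finite@(_ , enum) rad connected anticonnected
    (X , X-resp) ((x₀ , y₀ , Xx₀ , Xy₀ , x₀≉y₀) , (v , ¬Xv)) X-hom =
    finite⇒¬¬decidable setoid enum X-resp λ X? →
      let M[y₀-x₀] = difference∈MaxModule₀ (X-isProperModule X?) Xx₀ Xy₀
      in x₀≉y₀ (sym (x∙y⁻¹≈ε⇒x≈y y₀ x₀ (rad _
           (weaklyHomogeneous-leftIdeal⊆Rad finite MaxModule₀-respects (MaxModule₀-isLeftIdeal M[y₀-x₀])
              (MaxModule₀-proper finite) MaxModule₀-weaklyHomogeneous M[y₀-x₀]))))
    where
    open MaxModule q connected anticonnected
    X-isProperModule : Decidable X → IsProperModule X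
    X-isProperModule X? = record
      { decidable   = X?
      ; respects    = X-resp
      ; homogeneous = homogeneous⇒weaklyHomogeneous (X , X-resp) X-hom
      ; proper      = λ X-full → ¬Xv (X-full v)
      }

mainTheorem13 : ∀ {c ℓ p} (R : Ring c ℓ) → IsFinite R → RadZero R p →
    (U : Subset R p) → IsUnitSubgroup R U → let (U' , _) = U in U' (Ring.-_ R (Ring.1# R)) →
    (∀ (I : Subset R p) → IsTwoSidedIdeal R I →
       let (I' , _) = I in
       (∃[ x ] (I' x × ¬ (Ring._≈_ R x (Ring.0# R)))) → (∃[ y ] ¬ I' y) →
       ¬ Homogeneous R U I)
    × (Connected R U → AntiConnected R U → Prime R U p)
mainTheorem13 R finite rad U U-subgroup -1∈U =
  (λ I I-ideal → leftIdeal-¬homogeneous finite rad I (proj₁ I-ideal)) ,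
  connected-anticonnected⇒prime finite rad
  where open Cayley R U U-subgroup -1∈U
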